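{- Let $k\ge2$ and let $a\colon\mathbb{N}_0\to\{+1,-1\}$ be a pattern counting sequence. Then $a(kn)=a(n)$ for all $n\in\mathbb{N}_0$ if and only if there exists an admissible set $A\subset\Sigma_k^*$ in which no word begins with $\mathtt 0$ and no word ends with $\mathtt 0$, such that $a=a_A$.
   Context: $\Sigma_k=\{\mathtt 0,\dots,k-1\}$, $\Sigma_k^*$ the finite words over $\Sigma_k$; $(n)_k$ the base-$k$ expansion without leading zeros. For a word $v$ not of the form $\mathtt 0^j$ ($j\ge0$), $\#(v,n)$ is the number of pairs of words $(x,y)$ with $\mathtt 0^{|v|-1}(n)_k=xvy$. $A$ is admissible if finite and containing no word of the form $\mathtt 0^j$ ($j\ge0$); $a_A(n)=(-1)^{\sum_{v\in A}\#(v,n)}$; a pattern counting sequence is one of the form $a_A$ with $A$ admissible. -}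

module Defs where

open import Data.Nat using (ℕ; zero; suc; _+_; _∸_)
open import Data.Nat.DivMod using (_/_; _mod_)
open import Data.Fin using (Fin; toℕ)
import Data.Fin as Fin
open import Data.Fin.Properties using () renaming (_≟_ to _≟ᶠ_)
open import Data.List using (List; []; _∷_; _++_; length; replicate; reverse; map)
open import Data.Nat.ListAction using (sum)
open import Data.List.Relation.Unary.All using (All)
open import Data.List.Relation.Unary.Unique.Propositional using (Unique)
open import Data.List.Membership.Propositional using (_∈_)
open import Data.Integer using (ℤ; 1ℤ; -_)
open import Data.Bool using (Bool; true; false; _∧_)
open import Data.Product using (Σ; _×_)
open import Data.Empty using (⊥)
open import Relation.Binary.PropositionalEquality using (_≡_)
open import Relation.Nullary using (¬_)
open import Relation.Nullary.Decidable using (⌊_⌋)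

-- Words over Σ_k = {0,…,k-1}: lists of digits (Fin k), most significant first.
Word : ℕ → Set
Word k = List (Fin k)

-- Least-significant-first digits of n in base k, with fuel (fuel n suffices).
digitsRevF : (k : ℕ) → ℕ → ℕ → Word k
digitsRevF zero          _        _       = []
digitsRevF (suc k')      zero     _       = []
digitsRevF (suc k')      (suc f)  zero    = []
digitsRevF (suc k')      (suc f)  (suc n) =
  (suc n mod suc k') ∷ digitsRevF (suc k') f (suc n / suc k')

-- (n)_k : base-k expansion of n without leading zeros ((0)_k is the empty word).
-- Only meaningful for k ≥ 2.
base : (k : ℕ) → ℕ → Word k
base k n = reverse (digitsRevF k n n)

zeros : (k : ℕ) → ℕ → Word k
zeros zero    j = []   -- Σ_0 is empty; never used (k ≥ 2)
zeros (suc k) j = replicate j Fin.zero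

isPrefix : {k : ℕ} → Word k → Word k → Bool
isPrefix []       _        = true
isPrefix (_ ∷ _)  []       = false
isPrefix (a ∷ v)  (b ∷ w)  = ⌊ a ≟ᶠ b ⌋ ∧ isPrefix v w

ind : Bool → ℕ
ind true  = 1
ind false = 0

occ : {k : ℕ} → Word k → Word k → ℕ
occ v []       = ind (isPrefix v [])
occ v (b ∷ w)  = ind (isPrefix v (b ∷ w)) + occ v w

count : {k : ℕ} → Word k → ℕ → ℕ
count {k} v n = occ v (zeros k (length v ∸ 1) ++ base k n)

IsZeroWord : {k : ℕ} → Word k → Set
IsZeroWord v = All (λ d → toℕ d ≡ 0) v

-- A finite set of words: a duplicate-free list.
Admissible : {k : ℕ} → List (Word k) → Set
Admissible {k} A = Unique A × (∀ {v} → v ∈ A → ¬ IsZeroWord v)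

sgn : ℕ → ℤ
sgn zero    = 1ℤ
sgn (suc m) = - sgn m

patSeq : {k : ℕ} → List (Word k) → ℕ → ℤ
patSeq A n = sgn (sum (map (λ v → count v n) A))

PatternCounting : (k : ℕ) → (ℕ → ℤ) → Set
PatternCounting k a = Σ (List (Word k)) λ A → Admissible A × (∀ n → a n ≡ patSeq A n)

StartsWithZero : {k : ℕ} → Word k → Set
StartsWithZero []      = ⊥
StartsWithZero (d ∷ _) = toℕ d ≡ 0

EndsWithZero : {k : ℕ} → Word k → Set
EndsWithZero v = StartsWithZero (reverse v)

-- For n > 0 the expansion (kn)_k is (n)_k followed by one 0.  If v begins with
-- a nonzero digit, the zero padding in #(v,n) is irrelevant; if v also ends with
-- a nonzero digit, no occurrence of v ends at the appended 0, so #(v,kn) =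
-- #(v,n).  For the converse an admissible A is
-- transformed, keeping a_A, in three stages:
--   1. a word 0w is replaced by w and the words cw (c ≠ 0): every occurrence
--      of w in the padded expansion is preceded by exactly one digit;
--   2. a word w0 is replaced by w and the words wc (c ≠ 0): splitting the
--      occurrences of w by the digit that follows them shows that this turns
--      a_A(kn) into the pattern of the new list at n, which by a(kn) = a(n)
--      is again a_A; rounds are repeated until no word ends with 0;
--   3. equal words are cancelled in pairs, making the list duplicate-free.
module Submission where

open import Defs
open import Data.Nat using (ℕ; zero; suc; _+_; _*_; _≤_; s≤s; z≤n)
open import Data.Nat.Properties
  using ( +-assoc; +-comm; +-identityʳ; *-comm; *-zeroʳ; ≤-refl; ≤-trans; ≤-pred
        ; m≤m+n; m≤n+m; +-0-commutativeMonoid; +-commutativeSemigroup)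
open import Data.Nat.DivMod using (_/_; _mod_; _%_; m*n%n≡0; m*n/n≡m; m/n<m)
open import Data.Nat.ListAction using (sum)
open import Data.Nat.ListAction.Properties using (sum-++)
open import Algebra.Properties.CommutativeMonoid.Sum +-0-commutativeMonoid
  using (sum-syntax; ∑-distrib-+; sum-cong-≗; sum-replicate-zero)
open import Algebra.Properties.CommutativeSemigroup +-commutativeSemigroup
  using (interchange; xy∙z≈xz∙y)
open import Data.Integer using (ℤ; 1ℤ; -_) renaming (_*_ to _⊛_)
import Data.Integer.Properties as ℤₚ
open import Algebra.Properties.CommutativeSemigroup ℤₚ.*-commutativeSemigroup
  using () renaming (x∙yz≈y∙xz to ⊛-swap)
open import Data.Fin using (Fin; toℕ) renaming (zero to fz; suc to fs)
open import Data.Fin.Properties using (toℕ-injective; toℕ-fromℕ<) renaming (_≟_ to _≟ᶠ_)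
open import Data.List
  using (List; []; _∷_; _++_; _∷ʳ_; length; replicate; reverse; map; concatMap; tabulate; initLast; _∷ʳ′_)
open import Data.List.Properties using (map-++; map-cong-local; unfold-reverse; reverse-++; length-++; ≡-dec)
open import Data.List.Relation.Unary.All as All using (All; []; _∷_)
open import Data.List.Relation.Unary.All.Properties using (++⁺; concat⁺; map⁺; tabulate⁺)
open import Data.List.Relation.Unary.AllPairs using ([]; _∷_)
open import Data.List.Relation.Unary.Unique.Propositional using (Unique)
open import Data.List.Relation.Unary.Any using (here; there)
open import Data.List.Membership.Propositional using (_∈_)
open import Data.List.Relation.Binary.Subset.Propositional using (_⊆_)
open import Data.Bool using (Bool; true; false; _∧_; if_then_else_)
open import Data.Bool.Properties using (∧-zeroʳ)
open import Data.Product using (Σ; _×_; _,_; proj₁; proj₂)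
open import Data.Empty using (⊥-elim)
open import Function using (_∘_)
open import Function.Bundles using (_⇔_; mk⇔)
open import Relation.Nullary using (¬_; Dec; yes; no)
open import Relation.Nullary.Decidable using (⌊_⌋)
open import Relation.Binary.PropositionalEquality
open ≡-Reasoning

sgn-+ : ∀ m n → sgn (m + n) ≡ sgn m ⊛ sgn n
sgn-+ zero    n = sym (ℤₚ.*-identityˡ (sgn n))
sgn-+ (suc m) n = trans (cong -_ (sgn-+ m n)) (ℤₚ.neg-distribˡ-* (sgn m) (sgn n))

sgn-square : ∀ n → sgn n ⊛ sgn n ≡ 1ℤ
sgn-square zero    = refl
sgn-square (suc n) = begin
  - sgn n ⊛ - sgn n     ≡⟨ ℤₚ.neg-distribˡ-* (sgn n) (- sgn n) ⟨
  - (sgn n ⊛ - sgn n)   ≡⟨ cong -_ (ℤₚ.neg-distribʳ-* (sgn n) (sgn n)) ⟨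
  - - (sgn n ⊛ sgn n)   ≡⟨ ℤₚ.neg-involutive _ ⟩
  sgn n ⊛ sgn n         ≡⟨ sgn-square n ⟩
  1ℤ                    ∎

sgn-cancel : ∀ n z → sgn n ⊛ (sgn n ⊛ z) ≡ z
sgn-cancel n z = begin
  sgn n ⊛ (sgn n ⊛ z)  ≡⟨ ℤₚ.*-assoc (sgn n) (sgn n) z ⟨
  sgn n ⊛ sgn n ⊛ z    ≡⟨ cong (_⊛ z) (sgn-square n) ⟩
  1ℤ ⊛ z               ≡⟨ ℤₚ.*-identityˡ z ⟩
  z                    ∎

sgn-twice : ∀ a x → sgn (a + x + x) ≡ sgn a
sgn-twice a x = begin
  sgn (a + x + x)        ≡⟨ sgn-+ (a + x) x ⟩
  sgn (a + x) ⊛ sgn x    ≡⟨ cong (_⊛ sgn x) (sgn-+ a x) ⟩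
  sgn a ⊛ sgn x ⊛ sgn x  ≡⟨ ℤₚ.*-assoc (sgn a) (sgn x) (sgn x) ⟩
  sgn a ⊛ (sgn x ⊛ sgn x) ≡⟨ cong (sgn a ⊛_) (sgn-square x) ⟩
  sgn a ⊛ 1ℤ             ≡⟨ ℤₚ.*-identityʳ (sgn a) ⟩
  sgn a                  ∎

sum-map-tabulate : ∀ {A : Set} {m} (g : A → ℕ) (f : Fin m → A) →
  sum (map g (tabulate f)) ≡ ∑[ c < m ] g (f c)
sum-map-tabulate {m = zero}  g f = refl
sum-map-tabulate {m = suc m} g f = cong (g (f fz) +_) (sum-map-tabulate g (λ c → f (fs c)))

-- Pointwise equal summands have equal sums (stated with ∑ so that the
-- summands are inferred from the goal).
∑-cong : ∀ {m} {f g : Fin m → ℕ} → (∀ c → f c ≡ g c) → ∑[ c < m ] f c ≡ ∑[ c < m ] g c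
∑-cong f≗g = sum-cong-≗ f≗g

∑-δ : ∀ {m} (x : Fin m) (B : Bool) → ∑[ c < m ] ind (⌊ c ≟ᶠ x ⌋ ∧ B) ≡ ind B
∑-δ {suc m} fz     B = trans (cong (ind B +_) (sum-replicate-zero m)) (+-identityʳ (ind B))
∑-δ {suc m} (fs x) B =
  trans (∑-cong (λ c → cong (λ b → ind (b ∧ B)) (≟-suc c x))) (∑-δ x B)
  where
  ≟-suc : ∀ (c x : Fin m) → ⌊ fs c ≟ᶠ fs x ⌋ ≡ ⌊ c ≟ᶠ x ⌋
  ≟-suc c x with c ≟ᶠ x
  ... | yes _ = refl
  ... | no  _ = refl

-- Combinatorics of occurrences of words, over an arbitrary alphabet Σ_k.
module _ {k : ℕ} where

  _==_ : Word k → Word k → Bool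
  []      == []      = true
  []      == (_ ∷ _) = false
  (_ ∷ _) == []      = false
  (a ∷ u) == (b ∷ s) = ⌊ a ≟ᶠ b ⌋ ∧ (u == s)

  -- The number (0 or 1) of occurrences of u in t that end at the end of t.
  occEnd : Word k → Word k → ℕ
  occEnd u []      = ind (u == [])
  occEnd u (x ∷ t) = ind (u == (x ∷ t)) + occEnd u t

  isPrefix-[] : ∀ (u : Word k) → isPrefix u [] ≡ (u == [])
  isPrefix-[] []      = refl
  isPrefix-[] (_ ∷ _) = refl

  []≢snoc : ∀ (s : Word k) b → ([] == (s ∷ʳ b)) ≡ false
  []≢snoc []      b = refl
  []≢snoc (_ ∷ _) b = refl

  snoc≢[] : ∀ (s : Word k) b → ((s ∷ʳ b) == []) ≡ false
  snoc≢[] []      b = refl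
  snoc≢[] (_ ∷ _) b = refl

  ==-snoc : ∀ (w s : Word k) c b → ((w ∷ʳ c) == (s ∷ʳ b)) ≡ (⌊ c ≟ᶠ b ⌋ ∧ (w == s))
  ==-snoc []      []      c b = refl
  ==-snoc []      (x ∷ s) c b =
    trans (cong (⌊ c ≟ᶠ x ⌋ ∧_) ([]≢snoc s b)) (trans (∧-zeroʳ _) (sym (∧-zeroʳ _)))
  ==-snoc (y ∷ w) []      c b =
    trans (cong (⌊ y ≟ᶠ b ⌋ ∧_) (snoc≢[] w c)) (trans (∧-zeroʳ _) (sym (∧-zeroʳ _)))
  ==-snoc (y ∷ w) (x ∷ s) c b with y ≟ᶠ x
  ... | yes _ = ==-snoc w s c b
  ... | no  _ = sym (∧-zeroʳ _)

  isPrefix-snoc : ∀ (u s : Word k) b →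
    ind (isPrefix u (s ∷ʳ b)) ≡ ind (isPrefix u s) + ind (u == (s ∷ʳ b))
  isPrefix-snoc []      s       b = cong (λ e → 1 + ind e) (sym ([]≢snoc s b))
  isPrefix-snoc (y ∷ u) []      b with y ≟ᶠ b
  ... | yes _ = cong ind (isPrefix-[] u)
  ... | no  _ = refl
  isPrefix-snoc (y ∷ u) (z ∷ s) b with y ≟ᶠ z
  ... | yes _ = isPrefix-snoc u s b
  ... | no  _ = refl

  occ-snoc : ∀ (u s : Word k) b → occ u (s ∷ʳ b) ≡ occ u s + occEnd u (s ∷ʳ b)
  occ-snoc u [] b = begin
    ind (isPrefix u (b ∷ [])) + ind (isPrefix u [])
      ≡⟨ cong₂ _+_ (isPrefix-snoc u [] b) (cong ind (isPrefix-[] u)) ⟩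
    ind (isPrefix u []) + ind (u == (b ∷ [])) + ind (u == [])
      ≡⟨ +-assoc (ind (isPrefix u [])) _ _ ⟩
    ind (isPrefix u []) + (ind (u == (b ∷ [])) + ind (u == []))
      ∎
  occ-snoc u (x ∷ t) b = begin
    ind (isPrefix u (x ∷ t ∷ʳ b)) + occ u (t ∷ʳ b)
      ≡⟨ cong₂ _+_ (isPrefix-snoc u (x ∷ t) b) (occ-snoc u t b) ⟩
    ind (isPrefix u (x ∷ t)) + ind (u == (x ∷ t ∷ʳ b)) + (occ u t + occEnd u (t ∷ʳ b))
      ≡⟨ interchange (ind (isPrefix u (x ∷ t))) _ _ _ ⟩
    ind (isPrefix u (x ∷ t)) + occ u t + (ind (u == (x ∷ t ∷ʳ b)) + occEnd u (t ∷ʳ b))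
      ∎

  occEnd-snoc : ∀ (w t : Word k) c b →
    occEnd (w ∷ʳ c) (t ∷ʳ b) ≡ (if ⌊ c ≟ᶠ b ⌋ then occEnd w t else 0)
  occEnd-snoc w [] c b with c ≟ᶠ b | ==-snoc w [] c b
  ... | yes _ | eq = trans (cong₂ _+_ (cong ind eq) (cong ind (snoc≢[] w c))) (+-identityʳ _)
  ... | no  _ | eq = cong₂ _+_ (cong ind eq) (cong ind (snoc≢[] w c))
  occEnd-snoc w (x ∷ t) c b with c ≟ᶠ b | ==-snoc w (x ∷ t) c b | occEnd-snoc w t c b
  ... | yes _ | eq | ih = cong₂ _+_ (cong ind eq) ih
  ... | no  _ | eq | ih = cong₂ _+_ (cong ind eq) ih

  isPrefix-extendʳ : ∀ (w s : Word k) →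
    ∑[ c < k ] ind (isPrefix (w ∷ʳ c) s) + ind (w == s) ≡ ind (isPrefix w s)
  isPrefix-extendʳ []      []      = cong (_+ 1) (sum-replicate-zero k)
  isPrefix-extendʳ []      (x ∷ s) = trans (+-identityʳ _) (∑-δ x true)
  isPrefix-extendʳ (y ∷ w) []      = trans (+-identityʳ _) (sum-replicate-zero k)
  isPrefix-extendʳ (y ∷ w) (x ∷ s) with y ≟ᶠ x
  ... | yes _ = isPrefix-extendʳ w s
  ... | no  _ = trans (+-identityʳ _) (sum-replicate-zero k)

  -- Each occurrence of w in t is preceded by exactly one digit c, unless it
  -- starts t.
  occ-extendˡ : ∀ (w t : Word k) → ∑[ c < k ] occ (c ∷ w) t + ind (isPrefix w t) ≡ occ w t
  occ-extendˡ w [] = cong (_+ ind (isPrefix w [])) (sum-replicate-zero k)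
  occ-extendˡ w (x ∷ t) = begin
    ∑[ c < k ] (ind (⌊ c ≟ᶠ x ⌋ ∧ isPrefix w t) + occ (c ∷ w) t) + p
      ≡⟨ cong (_+ p) (∑-distrib-+ (λ c → ind (⌊ c ≟ᶠ x ⌋ ∧ isPrefix w t)) (λ c → occ (c ∷ w) t)) ⟩
    ∑[ c < k ] ind (⌊ c ≟ᶠ x ⌋ ∧ isPrefix w t) + O + p
      ≡⟨ cong (λ z → z + O + p) (∑-δ x (isPrefix w t)) ⟩
    ind (isPrefix w t) + O + p
      ≡⟨ cong (_+ p) (trans (+-comm (ind (isPrefix w t)) O) (occ-extendˡ w t)) ⟩
    occ w t + p
      ≡⟨ +-comm (occ w t) p ⟩
    p + occ w t
      ∎
    where
    p = ind (isPrefix w (x ∷ t))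
    O = ∑[ c < k ] occ (c ∷ w) t

  -- Each occurrence of w in t is followed by exactly one digit c, unless it
  -- ends t.
  occ-extendʳ : ∀ (w t : Word k) → ∑[ c < k ] occ (w ∷ʳ c) t + occEnd w t ≡ occ w t
  occ-extendʳ []      [] = cong (_+ 1) (sum-replicate-zero k)
  occ-extendʳ (_ ∷ _) [] = cong (_+ 0) (sum-replicate-zero k)
  occ-extendʳ w (x ∷ t) = begin
    ∑[ c < k ] (ind (isPrefix (w ∷ʳ c) (x ∷ t)) + occ (w ∷ʳ c) t) + (e + occEnd w t)
      ≡⟨ cong (_+ (e + occEnd w t)) (∑-distrib-+ (λ c → ind (isPrefix (w ∷ʳ c) (x ∷ t))) (λ c → occ (w ∷ʳ c) t)) ⟩
    P + O + (e + occEnd w t)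
      ≡⟨ interchange P O e (occEnd w t) ⟩
    P + e + (O + occEnd w t)
      ≡⟨ cong₂ _+_ (isPrefix-extendʳ w (x ∷ t)) (occ-extendʳ w t) ⟩
    ind (isPrefix w (x ∷ t)) + occ w t
      ∎
    where
    e = ind (w == (x ∷ t))
    P = ∑[ c < k ] ind (isPrefix (w ∷ʳ c) (x ∷ t))
    O = ∑[ c < k ] occ (w ∷ʳ c) t

  reverse-snoc : ∀ (w : Word k) c → reverse (w ∷ʳ c) ≡ c ∷ reverse w
  reverse-snoc w c = reverse-++ w (c ∷ [])

  endsWithZero-snoc-zero : ∀ (w : Word k) {c} → toℕ c ≡ 0 → EndsWithZero (w ∷ʳ c)
  endsWithZero-snoc-zero w {c} c≡0 = subst StartsWithZero (sym (reverse-snoc w c)) c≡0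

module _ {k : ℕ} where

  patSeq-++ : ∀ (L M : List (Word k)) n → patSeq (L ++ M) n ≡ patSeq L n ⊛ patSeq M n
  patSeq-++ L M n = trans
    (cong sgn (trans (cong sum (map-++ #n L M)) (sum-++ (map #n L) (map #n M))))
    (sgn-+ (sum (map #n L)) (sum (map #n M)))
    where
    #n : Word k → ℕ
    #n v = count v n

  patSeq-concatMap : ∀ (T : Word k → List (Word k)) {P : Word k → Set} {n m} →
    (∀ {v : Word k} → P v → patSeq (T v) n ≡ sgn (count v m)) →
    ∀ {L : List (Word k)} → All P L → patSeq (concatMap T L) n ≡ patSeq L m
  patSeq-concatMap T hyp [] = refl
  patSeq-concatMap T {n = n} {m} hyp {v ∷ L} (p ∷ ps) = begin
    patSeq (T v ++ concatMap T L) n         ≡⟨ patSeq-++ (T v) (concatMap T L) n ⟩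
    patSeq (T v) n ⊛ patSeq (concatMap T L) n ≡⟨ cong₂ _⊛_ (hyp p) (patSeq-concatMap T hyp ps) ⟩
    sgn (count v m) ⊛ patSeq L m            ≡⟨ sgn-+ (count v m) _ ⟨
    patSeq (v ∷ L) m                        ∎

  All-concatMap : ∀ (T : Word k → List (Word k)) {P Q : Word k → Set} →
    (∀ {v : Word k} → P v → All Q (T v)) → ∀ {L : List (Word k)} → All P L → All Q (concatMap T L)
  All-concatMap T f ps = concat⁺ (map⁺ (All.map f ps))

-- Stage 3 of the normalisation, which works over any alphabet: cancelling
-- equal pairs makes a list duplicate-free without changing its sign pattern.
module _ {k : ℕ} where

  _≟w_ : (u v : Word k) → Dec (u ≡ v)
  _≟w_ = ≡-dec _≟ᶠ_

  toggle : Word k → List (Word k) → List (Word k)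
  toggle v []      = v ∷ []
  toggle v (u ∷ M) with u ≟w v
  ... | yes _ = M
  ... | no  _ = u ∷ toggle v M

  -- Toggling the words of L one by one keeps exactly the words of odd multiplicity.
  cancelPairs : List (Word k) → List (Word k)
  cancelPairs []      = []
  cancelPairs (v ∷ L) = toggle v (cancelPairs L)

  toggle-⊆ : ∀ (v : Word k) M → toggle v M ⊆ v ∷ M
  toggle-⊆ v [] p = p
  toggle-⊆ v (u ∷ M) p with u ≟w v
  ... | yes _ = there (there p)
  toggle-⊆ v (u ∷ M) (here e)  | no _ = there (here e)
  toggle-⊆ v (u ∷ M) (there p) | no _ with toggle-⊆ v M p
  ... | here e  = here e
  ... | there q = there (there q)

  cancelPairs-⊆ : ∀ L → cancelPairs L ⊆ L
  cancelPairs-⊆ (v ∷ L) p with toggle-⊆ v (cancelPairs L) p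
  ... | here e  = here e
  ... | there q = there (cancelPairs-⊆ L q)

  toggle-unique : ∀ (v : Word k) M → Unique M → Unique (toggle v M)
  toggle-unique v []      _          = [] ∷ []
  toggle-unique v (u ∷ M) (u∉M ∷ uM) with u ≟w v
  ... | yes _   = uM
  ... | no  u≢v = All.tabulate u∉toggle ∷ toggle-unique v M uM
    where
    u∉toggle : ∀ {x} → x ∈ toggle v M → ¬ u ≡ x
    u∉toggle q with toggle-⊆ v M q
    ... | here x≡v = λ u≡x → u≢v (trans u≡x x≡v)
    ... | there r  = All.lookup u∉M r

  cancelPairs-unique : ∀ L → Unique (cancelPairs L)
  cancelPairs-unique []      = []
  cancelPairs-unique (v ∷ L) = toggle-unique v (cancelPairs L) (cancelPairs-unique L)

  -- ... and since sgn(#(v,n))² = 1, toggling v multiplies the sign pattern by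
  -- sgn(#(v,n)), as adding v does.
  toggle-sign : ∀ n (v : Word k) M → patSeq (toggle v M) n ≡ sgn (count v n) ⊛ patSeq M n
  toggle-sign n v [] = sgn-+ (count v n) 0
  toggle-sign n v (u ∷ M) with u ≟w v
  ... | yes refl = sym (trans (cong (sgn (count v n) ⊛_) (sgn-+ (count v n) _)) (sgn-cancel (count v n) _))
  ... | no  _    = begin
    patSeq (u ∷ toggle v M) n               ≡⟨ sgn-+ (count u n) _ ⟩
    sgn (count u n) ⊛ patSeq (toggle v M) n ≡⟨ cong (sgn (count u n) ⊛_) (toggle-sign n v M) ⟩
    sgn (count u n) ⊛ (sgn (count v n) ⊛ patSeq M n) ≡⟨ ⊛-swap (sgn (count u n)) (sgn (count v n)) (patSeq M n) ⟩
    sgn (count v n) ⊛ (sgn (count u n) ⊛ patSeq M n) ≡⟨ cong (sgn (count v n) ⊛_) (sgn-+ (count u n) _) ⟨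
    sgn (count v n) ⊛ patSeq (u ∷ M) n      ∎

  cancelPairs-sign : ∀ n L → patSeq (cancelPairs L) n ≡ patSeq L n
  cancelPairs-sign n []      = refl
  cancelPairs-sign n (v ∷ L) = begin
    patSeq (toggle v (cancelPairs L)) n         ≡⟨ toggle-sign n v (cancelPairs L) ⟩
    sgn (count v n) ⊛ patSeq (cancelPairs L) n  ≡⟨ cong (sgn (count v n) ⊛_) (cancelPairs-sign n L) ⟩
    sgn (count v n) ⊛ patSeq L n                ≡⟨ sgn-+ (count v n) _ ⟨
    patSeq (v ∷ L) n                            ∎

module Radix (K : ℕ) where

  k : ℕ
  k = suc (suc K)

  digits-fuel : ∀ f f′ n → n ≤ f → n ≤ f′ → digitsRevF k f n ≡ digitsRevF k f′ n
  digits-fuel zero    zero     zero    _ _ = refl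
  digits-fuel zero    (suc _)  zero    _ _ = refl
  digits-fuel (suc _) zero     zero    _ _ = refl
  digits-fuel (suc _) (suc _)  zero    _ _ = refl
  digits-fuel (suc f) (suc f′) (suc n) (s≤s n≤f) (s≤s n≤f′) =
    cong ((suc n mod k) ∷_) (digits-fuel f f′ (suc n / k) (quotient≤ n≤f) (quotient≤ n≤f′))
    where
    quotient≤ : ∀ {g} → n ≤ g → suc n / k ≤ g
    quotient≤ n≤g = ≤-pred (≤-trans (m/n<m (suc n) k (s≤s (s≤s z≤n))) (s≤s n≤g))

  base-scale : ∀ m → base k (k * suc m) ≡ base k (suc m) ∷ʳ fz
  base-scale m = trans (cong reverse digits) (unfold-reverse fz (digitsRevF k (suc m) (suc m)))
    where
    P = m + suc K * suc m
    last-digit : (k * suc m) mod k ≡ fz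
    last-digit = toℕ-injective (trans (toℕ-fromℕ< _)
      (trans (cong (_% k) (*-comm k (suc m))) (m*n%n≡0 (suc m) k)))
    quotient : (k * suc m) / k ≡ suc m
    quotient = trans (cong (_/ k) (*-comm k (suc m))) (m*n/n≡m (suc m) k)
    enough-fuel : suc m ≤ P
    enough-fuel = ≤-trans (m≤m+n (suc m) (K * suc m)) (m≤n+m (suc K * suc m) m)
    digits : digitsRevF k (k * suc m) (k * suc m) ≡ fz ∷ digitsRevF k (suc m) (suc m)
    digits = cong₂ _∷_ last-digit
      (trans (cong (digitsRevF k P) quotient) (digits-fuel P (suc m) (suc m) enough-fuel ≤-refl))

  endsWithZero-snoc-suc : ∀ (w : Word k) x → ¬ EndsWithZero (w ∷ʳ fs x)
  endsWithZero-snoc-suc w x e with subst StartsWithZero (reverse-snoc w (fs x)) e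
  ... | ()

  data StartsNonzero : Word k → Set where
    leads : ∀ x v → StartsNonzero (fs x ∷ v)

  startsNonzero-nonzeroWord : ∀ {v : Word k} → StartsNonzero v → ¬ IsZeroWord v
  startsNonzero-nonzeroWord (leads x v) (() ∷ _)

  startsNonzero-notStartsWithZero : ∀ {v : Word k} → StartsNonzero v → ¬ StartsWithZero v
  startsNonzero-notStartsWithZero (leads x v) ()

  startsNonzero : ∀ {v : Word k} → ¬ IsZeroWord v → ¬ StartsWithZero v → StartsNonzero v
  startsNonzero {[]}       nz _  = ⊥-elim (nz [])
  startsNonzero {fz ∷ w}   _  sz = ⊥-elim (sz refl)
  startsNonzero {fs x ∷ w} _  _  = leads x w

  startsNonzero-snoc : ∀ {w : Word k} c → StartsNonzero w → StartsNonzero (w ∷ʳ c)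
  startsNonzero-snoc c (leads x v) = leads x (v ∷ʳ c)

  startsNonzero-init : ∀ {w : Word k} → StartsNonzero (w ∷ʳ fz) → StartsNonzero w
  startsNonzero-init {fs x ∷ w} _ = leads x w
  startsNonzero-init {fz ∷ w}   ()
  startsNonzero-init {[]}       ()

  occ-zero-padding : ∀ x (v : Word k) j s → occ (fs x ∷ v) (replicate j fz ++ s) ≡ occ (fs x ∷ v) s
  occ-zero-padding x v zero    s = refl
  occ-zero-padding x v (suc j) s = occ-zero-padding x v j s

  count-startsNonzero : ∀ {v : Word k} → StartsNonzero v → ∀ n → count v n ≡ occ v (base k n)
  count-startsNonzero (leads x v) n = occ-zero-padding x v (length v) (base k n)

  -- #(v, kn) counts v in (n)_k 0 (also for n = 0, where both sides vanish).
  count-scale : ∀ {v : Word k} → StartsNonzero v → ∀ n → count v (k * n) ≡ occ v (base k n ∷ʳ fz)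
  count-scale {v} sv@(leads _ _) zero =
    trans (cong (count v) (*-zeroʳ k)) (count-startsNonzero sv zero)
  count-scale sv (suc m) =
    trans (count-startsNonzero sv (k * suc m)) (cong (occ _) (base-scale m))

  count-scale-invariant : ∀ {v : Word k} → StartsNonzero v → ¬ EndsWithZero v → ∀ n → count v (k * n) ≡ count v n
  count-scale-invariant {v} sv ez n with initLast v
  count-scale-invariant () ez n | []
  ... | w ∷ʳ′ fz   = ⊥-elim (ez (endsWithZero-snoc-zero w refl))
  ... | w ∷ʳ′ fs x = begin
    count (w ∷ʳ fs x) (k * n)                           ≡⟨ count-scale sv n ⟩
    occ (w ∷ʳ fs x) (s ∷ʳ fz)                           ≡⟨ occ-snoc (w ∷ʳ fs x) s fz ⟩
    occ (w ∷ʳ fs x) s + occEnd (w ∷ʳ fs x) (s ∷ʳ fz)    ≡⟨ cong (occ (w ∷ʳ fs x) s +_) (occEnd-snoc w s (fs x) fz) ⟩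
    occ (w ∷ʳ fs x) s + 0                               ≡⟨ +-identityʳ _ ⟩
    occ (w ∷ʳ fs x) s                                   ≡⟨ count-startsNonzero sv n ⟨
    count (w ∷ʳ fs x) n                                 ∎
    where s = base k n

  zeros-not-prefix : ∀ {w : Word k} s → ¬ IsZeroWord w → isPrefix w (replicate (length w) fz ++ s) ≡ false
  zeros-not-prefix {[]}       s nz = ⊥-elim (nz [])
  zeros-not-prefix {fz ∷ w}   s nz = zeros-not-prefix s (λ z → nz (refl ∷ z))
  zeros-not-prefix {fs x ∷ w} s nz = refl

  -- Every occurrence of a nonzero word w in its padded expansion is preceded
  -- by exactly one digit: #(w, n) = Σ_c #(cw, n).
  count-extendˡ : ∀ {w : Word k} → ¬ IsZeroWord w → ∀ n → count w n ≡ ∑[ c < k ] count (c ∷ w) n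
  count-extendˡ {[]}    nz n = ⊥-elim (nz [])
  count-extendˡ {y ∷ w} nz n = begin
    count (y ∷ w) n                                  ≡⟨ cong (λ b → ind b + count (y ∷ w) n) not-prefix ⟨
    occ (y ∷ w) t                                    ≡⟨ occ-extendˡ (y ∷ w) t ⟨
    ∑[ c < k ] count (c ∷ y ∷ w) n + ind (isPrefix (y ∷ w) t)
                                                     ≡⟨ cong (λ b → ∑[ c < k ] count (c ∷ y ∷ w) n + ind b) not-prefix ⟩
    ∑[ c < k ] count (c ∷ y ∷ w) n + 0               ≡⟨ +-identityʳ _ ⟩
    ∑[ c < k ] count (c ∷ y ∷ w) n                   ∎
    where
    t = replicate (length (y ∷ w)) fz ++ base k n
    not-prefix : isPrefix (y ∷ w) t ≡ false
    not-prefix = zeros-not-prefix (base k n) nz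

  expandLeadingZeros : Word k → List (Word k)
  expandLeadingZeros (fz ∷ w) = expandLeadingZeros w ++ tabulate (λ c → fs c ∷ w)
  expandLeadingZeros v        = v ∷ []

  expandLeadingZeros-startsNonzero : ∀ {v : Word k} → ¬ IsZeroWord v → All StartsNonzero (expandLeadingZeros v)
  expandLeadingZeros-startsNonzero {[]}       nz = ⊥-elim (nz [])
  expandLeadingZeros-startsNonzero {fz ∷ w}   nz =
    ++⁺ (expandLeadingZeros-startsNonzero (λ z → nz (refl ∷ z))) (tabulate⁺ (λ c → leads c w))
  expandLeadingZeros-startsNonzero {fs x ∷ w} _  = leads x w ∷ []

  expandLeadingZeros-sign : ∀ {v : Word k} → ¬ IsZeroWord v → ∀ n → patSeq (expandLeadingZeros v) n ≡ sgn (count v n)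
  expandLeadingZeros-sign {[]}       nz n = ⊥-elim (nz [])
  expandLeadingZeros-sign {fs x ∷ w} _  n = cong sgn (+-identityʳ (count (fs x ∷ w) n))
  expandLeadingZeros-sign {fz ∷ w}   nz n = begin
    patSeq (expandLeadingZeros w ++ tabulate (λ c → fs c ∷ w)) n
      ≡⟨ patSeq-++ (expandLeadingZeros w) _ n ⟩
    patSeq (expandLeadingZeros w) n ⊛ patSeq (tabulate (λ c → fs c ∷ w)) n
      ≡⟨ cong₂ _⊛_ (expandLeadingZeros-sign nzw n) (cong sgn (sum-map-tabulate (λ v → count v n) (λ c → fs c ∷ w))) ⟩
    sgn (count w n) ⊛ sgn X
      ≡⟨ sgn-+ (count w n) X ⟨
    sgn (count w n + X)
      ≡⟨ cong (λ z → sgn (z + X)) (count-extendˡ nzw n) ⟩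
    sgn (count (fz ∷ w) n + X + X)
      ≡⟨ sgn-twice (count (fz ∷ w) n) X ⟩
    sgn (count (fz ∷ w) n)
      ∎
    where
    nzw : ¬ IsZeroWord w
    nzw z = nz (refl ∷ z)
    X = ∑[ c < suc K ] count (fs c ∷ w) n

  leadingZeros-startsNonzero : ∀ {A : List (Word k)} → All (λ v → ¬ IsZeroWord v) A →
    All StartsNonzero (concatMap expandLeadingZeros A)
  leadingZeros-startsNonzero = All-concatMap expandLeadingZeros expandLeadingZeros-startsNonzero

  leadingZeros-sign : ∀ {A : List (Word k)} → All (λ v → ¬ IsZeroWord v) A →
    ∀ n → patSeq (concatMap expandLeadingZeros A) n ≡ patSeq A n
  leadingZeros-sign nzs n =
    patSeq-concatMap expandLeadingZeros {n = n} {m = n} (λ nz → expandLeadingZeros-sign nz n) nzs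

  expandTrailingZero : Word k → List (Word k)
  expandTrailingZero v with initLast v
  ... | w ∷ʳ′ fz = w ∷ tabulate (λ c → w ∷ʳ fs c)
  ... | _        = v ∷ []

  expandTrailingZero-startsNonzero : ∀ {v : Word k} → StartsNonzero v → All StartsNonzero (expandTrailingZero v)
  expandTrailingZero-startsNonzero {v} sv with initLast v
  expandTrailingZero-startsNonzero () | []
  ... | w ∷ʳ′ fz   = sw ∷ tabulate⁺ (λ c → startsNonzero-snoc (fs c) sw)
    where sw = startsNonzero-init sv
  ... | w ∷ʳ′ fs x = sv ∷ []

  -- For v = w0 with s = (n)_k this is the parity identity
  --   #(w,n) + Σ_{c≠0} #(wc,n) ≡ occ(w0,s) + occEnd(w,s) = #(w0, kn)  (mod 2),
  -- obtained by splitting the occurrences of w in s by their following digit.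
  expandTrailingZero-sign : ∀ {v : Word k} → StartsNonzero v → ∀ n → patSeq (expandTrailingZero v) n ≡ sgn (count v (k * n))
  expandTrailingZero-sign {v} sv n with initLast v
  expandTrailingZero-sign () n | []
  ... | w ∷ʳ′ fs x = cong sgn (trans (+-identityʳ _)
                       (sym (count-scale-invariant sv (endsWithZero-snoc-suc w x) n)))
  ... | w ∷ʳ′ fz   = begin
    sgn (count w n + sum (map (λ u → count u n) (tabulate (λ c → w ∷ʳ fs c))))
      ≡⟨ cong₂ (λ a b → sgn (a + b)) (count-startsNonzero sw n) tail-sum ⟩
    sgn (occ w s + X)
      ≡⟨ cong (λ z → sgn (z + X)) (occ-extendʳ w s) ⟨
    sgn (occ (w ∷ʳ fz) s + X + occEnd w s + X)
      ≡⟨ cong (λ z → sgn (z + X)) (xy∙z≈xz∙y (occ (w ∷ʳ fz) s) X (occEnd w s)) ⟩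
    sgn (occ (w ∷ʳ fz) s + occEnd w s + X + X)
      ≡⟨ sgn-twice (occ (w ∷ʳ fz) s + occEnd w s) X ⟩
    sgn (occ (w ∷ʳ fz) s + occEnd w s)
      ≡⟨ cong (λ z → sgn (occ (w ∷ʳ fz) s + z)) (occEnd-snoc w s fz fz) ⟨
    sgn (occ (w ∷ʳ fz) s + occEnd (w ∷ʳ fz) (s ∷ʳ fz))
      ≡⟨ cong sgn (occ-snoc (w ∷ʳ fz) s fz) ⟨
    sgn (occ (w ∷ʳ fz) (s ∷ʳ fz))
      ≡⟨ cong sgn (count-scale sv n) ⟨
    sgn (count (w ∷ʳ fz) (k * n))
      ∎
    where
    s = base k n
    sw = startsNonzero-init sv
    X = ∑[ c < suc K ] occ (w ∷ʳ fs c) s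
    tail-sum : sum (map (λ u → count u n) (tabulate (λ c → w ∷ʳ fs c))) ≡ X
    tail-sum = trans (sum-map-tabulate (λ u → count u n) (λ c → w ∷ʳ fs c))
      (∑-cong (λ c → count-startsNonzero (startsNonzero-snoc (fs c) sw) n))

  -- Termination measure of stage 2: every word ending in 0 has length ≤ m.
  ZeroEndBound : ℕ → Word k → Set
  ZeroEndBound m v = EndsWithZero v → length v ≤ m

  zeroEndBound-zero : ∀ {v : Word k} → ZeroEndBound 0 v → ¬ EndsWithZero v
  zeroEndBound-zero {[]}    _     ()
  zeroEndBound-zero {_ ∷ _} bound e with bound e
  ... | ()

  expandTrailingZero-bound : ∀ {m} {v : Word k} → ZeroEndBound (suc m) v → All (ZeroEndBound m) (expandTrailingZero v)
  expandTrailingZero-bound {m} {v} bound with initLast v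
  ... | []         = (λ ()) ∷ []
  ... | w ∷ʳ′ fz   =
        (λ _ → ≤-pred (subst (_≤ suc m) (trans (length-++ w {fz ∷ []}) (+-comm (length w) 1))
                                        (bound (endsWithZero-snoc-zero w refl))))
        ∷ tabulate⁺ {f = λ c → w ∷ʳ fs c} (λ c e → ⊥-elim (endsWithZero-snoc-suc w c e))
  ... | w ∷ʳ′ fs x = (λ e → ⊥-elim (endsWithZero-snoc-suc w x e)) ∷ []

  length-≤-total : ∀ (L : List (Word k)) → All (λ v → length v ≤ sum (map length L)) L
  length-≤-total []      = []
  length-≤-total (v ∷ L) = m≤m+n (length v) _
    ∷ All.map (λ v≤ → ≤-trans v≤ (m≤n+m _ (length v))) (length-≤-total L)

  ScaleInvariant : List (Word k) → Set
  ScaleInvariant L = ∀ n → patSeq L (k * n) ≡ patSeq L n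

  NonzeroEndsForm : List (Word k) → Set
  NonzeroEndsForm L = Σ (List (Word k)) λ L′ →
    All StartsNonzero L′ × All (λ v → ¬ EndsWithZero v) L′ × (∀ n → patSeq L′ n ≡ patSeq L n)

  -- Each round turns the pattern at kn into the pattern at n; scale invariance
  -- makes this the original pattern and is inherited by the new list.
  removeTrailingZeros : ∀ m L → All StartsNonzero L → All (ZeroEndBound m) L → ScaleInvariant L →
    NonzeroEndsForm L
  removeTrailingZeros zero L sn bounds _ =
    L , sn , All.map (λ {v} → zeroEndBound-zero {v}) bounds , λ _ → refl
  removeTrailingZeros (suc m) L sn bounds inv =
    extend (removeTrailingZeros m L₁ sn₁ bounds₁ inv₁)
    where
    L₁ = concatMap expandTrailingZero L
    sn₁ = All-concatMap expandTrailingZero expandTrailingZero-startsNonzero sn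
    bounds₁ = All-concatMap expandTrailingZero expandTrailingZero-bound bounds
    L₁-sign : ∀ n → patSeq L₁ n ≡ patSeq L (k * n)
    L₁-sign n = patSeq-concatMap expandTrailingZero {n = n} {m = k * n} (λ sv → expandTrailingZero-sign sv n) sn
    inv₁ : ScaleInvariant L₁
    inv₁ n = trans (L₁-sign (k * n)) (trans (inv (k * n)) (sym (L₁-sign n)))
    extend : NonzeroEndsForm L₁ → NonzeroEndsForm L
    extend (L′ , sn′ , ez′ , eq′) = L′ , sn′ , ez′ , λ n → trans (eq′ n) (trans (L₁-sign n) (inv n))

  Normalised : (ℕ → ℤ) → Set
  Normalised a = Σ (List (Word k)) λ A → Admissible A
    × (∀ {v : Word k} → v ∈ A → ¬ StartsWithZero v)
    × (∀ {v : Word k} → v ∈ A → ¬ EndsWithZero v)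
    × (∀ n → a n ≡ patSeq A n)

  normalised-scale-invariant : ∀ a → Normalised a → ∀ n → a (k * n) ≡ a n
  normalised-scale-invariant a (A , (_ , nzA) , szA , ezA , a≡) n = begin
    a (k * n)           ≡⟨ a≡ (k * n) ⟩
    patSeq A (k * n)    ≡⟨ cong (sgn ∘ sum) (map-cong-local (All.tabulate invariant)) ⟩
    patSeq A n          ≡⟨ a≡ n ⟨
    a n                 ∎
    where
    invariant : ∀ {v : Word k} → v ∈ A → count v (k * n) ≡ count v n
    invariant v∈A = count-scale-invariant (startsNonzero (nzA v∈A) (szA v∈A)) (ezA v∈A) n

  cancelPairs-normalised : ∀ a {L : List (Word k)} → (∀ n → a n ≡ patSeq L n) → NonzeroEndsForm L →
    Normalised a
  cancelPairs-normalised a a≡ (L′ , sn , ez , L′-sign) =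
    cancelPairs L′
    , (cancelPairs-unique L′ , λ v∈ → startsNonzero-nonzeroWord (sn′ v∈))
    , (λ v∈ → startsNonzero-notStartsWithZero (sn′ v∈))
    , (λ v∈ → All.lookup ez (cancelPairs-⊆ L′ v∈))
    , λ n → trans (a≡ n) (sym (trans (cancelPairs-sign n L′) (L′-sign n)))
    where
    sn′ : ∀ {v : Word k} → v ∈ cancelPairs L′ → StartsNonzero v
    sn′ v∈ = All.lookup sn (cancelPairs-⊆ L′ v∈)

  normalise : ∀ a → PatternCounting k a → (∀ n → a (k * n) ≡ a n) → Normalised a
  normalise a (A , (_ , nzA) , a≡) inv =
    cancelPairs-normalised a {L₁} a≡₁ (removeTrailingZeros (sum (map length L₁)) L₁ sn₁ bounds₁ inv₁)
    where
    nzs = All.tabulate nzA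
    L₁ = concatMap expandLeadingZeros A
    sn₁ = leadingZeros-startsNonzero nzs
    a≡₁ : ∀ n → a n ≡ patSeq L₁ n
    a≡₁ n = trans (a≡ n) (sym (leadingZeros-sign nzs n))
    inv₁ : ScaleInvariant L₁
    inv₁ n = trans (sym (a≡₁ (k * n))) (trans (inv n) (a≡₁ n))
    bounds₁ = All.map (λ v≤ _ → v≤) (length-≤-total L₁)

lemma2p8 : (k : ℕ) → 2 ≤ k → (a : ℕ → ℤ) → PatternCounting k a →
    ((∀ n → a (k * n) ≡ a n) ⇔
     Σ (List (Word k)) λ A → Admissible A
       × (∀ {v : Word k} → v ∈ A → ¬ StartsWithZero v)
       × (∀ {v : Word k} → v ∈ A → ¬ EndsWithZero v)
       × (∀ n → a n ≡ patSeq A n))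
lemma2p8 (suc (suc K)) (s≤s (s≤s z≤n)) a pc =
  mk⇔ (normalise a pc) (normalised-scale-invariant a)
  where open Radix K
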